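{- Let $P$ be a finite poset and let $Q$ be a fracturing of $P$ with components $Q_1,\dots,Q_u$. Then $Q$ is a good fracturing if and only if $Q\supseteq\mathrm{Min}(P)$ and the conflict digraph $\mathrm{Con}(Q)$ is acyclic.
   Context: Let $I$ be the underlying set of $P$ and $\mathrm{Min}(P)$ its set of minimal elements. A set composition $\Phi=\Phi_1|\cdots|\Phi_m\models I$ is an ordered partition into nonempty blocks. For a grounded set family $(\mathcal{F},I)$ ($\emptyset\in\mathcal{F}\subseteq2^I$) let $\mathcal{F}_i=\{A\cap\Phi_i:A\in\mathcal{F},\ A\cap\Phi_j=\emptyset\ \forall j<i\}$ and $\mu_\Phi\Delta_\Phi(\mathcal{F})=\{X_1\cup\cdots\cup X_m:X_i\in\mathcal{F}_i\}$. $J(P)$ is the family of order ideals of $P$. A fracturing of $P$ is a poset $Q$ on a subset of $P$ that is a disjoint union of induced subposets of $P$ ($x<_Qy$ iff $x,y$ in the same summand and $x<_Py$); its components are the connected components of its Hasse diagram. $Q$ is good if there exists $\Phi\models I$ with $\mu_\Phi\Delta_\Phi(J(P))=J(Q)$. The conflict digraph $\mathrm{Con}(Q)$ has vertices $Q_1,\dots,Q_u$ and an edge $Q_i\to Q_j$ ($i\ne j$) whenever there exist $x\in Q_i$, $y\in Q_j$ with $y<_P x$. -}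

module Defs where

open import Level using (0ℓ)
open import Data.Nat using (ℕ)
open import Data.Fin using (Fin; _<_)
open import Data.Fin.Subset using (Subset; _∈_; _∉_; _∩_; _⊆_; ⊥)
open import Data.Vec using (tabulate)
open import Data.Bool using (Bool)
open import Data.Product using (Σ; ∃; _×_; _,_)
open import Data.Sum using (_⊎_)
open import Function using (Surjective)
open import Function.Bundles using (_⇔_)
open import Relation.Nullary using (¬_; does)
open import Relation.Binary using (Rel; IsDecPartialOrder)
open import Relation.Binary.PropositionalEquality using (_≡_; _≢_)
open import Relation.Binary.Construct.Closure.ReflexiveTransitive using (Star)
open import Relation.Binary.Construct.Closure.Transitive using (TransClosure)
import Data.Fin as F

record FinPoset (n : ℕ) : Set₁ where
  field
    _≤P_      : Rel (Fin n) 0ℓ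
    isDecPO   : IsDecPartialOrder _≡_ _≤P_

  _<P_ : Rel (Fin n) 0ℓ
  x <P y = x ≤P y × x ≢ y

open FinPoset public

Family : ℕ → Set₁
Family n = Subset n → Set

IsMin : ∀ {n} → FinPoset n → Fin n → Set
IsMin P x = ∀ y → _≤P_ P y x → y ≡ x

J : ∀ {n} → FinPoset n → Family n
J P A = ∀ x y → y ∈ A → _≤P_ P x y → x ∈ A

-- A fracturing Q of P is given by its underlying set
-- S ⊆ I together with a labelling `summand` of elements by the index
-- of the induced subposet (summand) of P they belong to:
--   x ≤Q y  iff  x, y ∈ S, same summand, and x ≤P y.

record Fracturing {n : ℕ} (P : FinPoset n) : Set where
  field
    S       : Subset n
    summand : Fin n → ℕ

open Fracturing public

module _ {n : ℕ} {P : FinPoset n} (Q : Fracturing P) where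

  _≤Q_ : Rel (Fin n) 0ℓ
  x ≤Q y = x ∈ S Q × y ∈ S Q × summand Q x ≡ summand Q y × _≤P_ P x y

  _<Q_ : Rel (Fin n) 0ℓ
  x <Q y = x ≤Q y × x ≢ y

  _⋖Q_ : Rel (Fin n) 0ℓ
  x ⋖Q y = x <Q y × (∀ z → ¬ (x <Q z × z <Q y))

  HasseEdge : Rel (Fin n) 0ℓ
  HasseEdge x y = x ⋖Q y ⊎ y ⋖Q x

  SameComp : Rel (Fin n) 0ℓ
  SameComp = Star HasseEdge

  JQ : Family n
  JQ A = A ⊆ S Q × (∀ x y → y ∈ A → x ≤Q y → x ∈ A)

  -- Edge of the conflict digraph Con(Q), between the components
  -- containing a and b:  Q_a ≠ Q_b and ∃ x ∈ Q_a, y ∈ Q_b, y <P x.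
  ConEdge : Rel (Fin n) 0ℓ
  ConEdge a b = a ∈ S Q × b ∈ S Q × ¬ SameComp a b
              × ∃ λ x → ∃ λ y → SameComp a x × SameComp b y × _<P_ P y x

  ConAcyclic : Set
  ConAcyclic = ∀ a → a ∈ S Q → ¬ TransClosure ConEdge a a

  ContainsMin : Set
  ContainsMin = ∀ x → IsMin P x → x ∈ S Q

-- Set compositions Φ = Φ₁|⋯|Φ_m ⊨ I: given by φ : I → Fin m sending
-- each element to the index of its block; surjectivity = blocks nonempty.

record SetComposition (n : ℕ) : Set where
  field
    m    : ℕ
    φ    : Fin n → Fin m
    surj : Surjective _≡_ _≡_ φ

open SetComposition public

block : ∀ {n} (Φ : SetComposition n) → Fin (m Φ) → Subset n
block Φ i = tabulate (λ x → does (φ Φ x F.≟ i))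

restrictFam : ∀ {n} (Φ : SetComposition n) → Family n → Fin (m Φ) → Family n
restrictFam Φ 𝓕 i X =
  ∃ λ A → 𝓕 A × (∀ j → j < i → A ∩ block Φ j ≡ ⊥) × X ≡ A ∩ block Φ i

μΔ : ∀ {n} (Φ : SetComposition n) → Family n → Family n
μΔ {n} Φ 𝓕 X = ∃ λ (Xs : Fin (m Φ) → Subset n) →
  (∀ i → restrictFam Φ 𝓕 i (Xs i)) × (∀ x → (x ∈ X) ⇔ (∃ λ i → x ∈ Xs i))

Good : ∀ {n} {P : FinPoset n} → Fracturing P → Set
Good {n} {P} Q = ∃ λ (Φ : SetComposition n) →
  ∀ X → μΔ Φ (J P) X ⇔ JQ Q X

{-# OPTIONS --safe #-}

-- If Φ witnesses goodness, the principal ideals of Q lie in μ_ΦΔ_Φ(J(P)) and stay there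
-- when any one block is deleted; hence comparable elements of Q, and so whole components,
-- share a block, while a conflict edge Q_i → Q_j puts Q_i in a strictly earlier block.
-- This makes Con(Q) acyclic, and the singleton of a minimal element of P, which lies in
-- μ_ΦΔ_Φ(J(P)), must be an ideal of Q.
-- Conversely, rank each element by the number of elements that must precede it (those with
-- a conflict path to it, and all of Q for elements outside Q) and compress the ranks into a
-- set composition. Membership in μ_ΦΔ_Φ(J(P)) can be tested block by block (X agrees on Φ_i
-- with an ideal of P avoiding the earlier blocks), and below an element of Q every P-smaller
-- element is Q-smaller or in a later block, which gives μ_ΦΔ_Φ(J(P)) = J(Q).

module Submission where

open import Defs
open import Level using (Level; 0ℓ)
open import Data.Nat as ℕ using (ℕ; zero; suc; s≤s)
import Data.Nat.Properties as ℕ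
open import Data.Fin as F using (Fin; fromℕ<; punchOut)
import Data.Fin.Properties as F
open import Data.Fin.Properties using (any?; all?)
open import Data.Fin.Subset using (Subset; _∈_; _∉_; _⊆_; _⊂_; _⊃_; _∩_; ⊥; ⁅_⁆; ∣_∣)
open import Data.Fin.Subset.Properties
  using (_∈?_; ⊆-antisym; ∉⊥; x∈p∩q⁺; x∈p∩q⁻; Empty-unique; x∈⁅x⁆; x∈⁅y⁆⇒x≡y)
  using (p⊂q⇒∣p∣<∣q∣; ∣p∣≤n)
open import Data.Fin.Subset.Induction using (⊂-wellFounded; ⊃-wellFounded)
open import Data.Fin.Induction using (po-wellFounded)
open import Data.Vec using (tabulate)
open import Data.Vec.Properties using (lookup∘tabulate; []=⇒lookup; lookup⇒[]=)
open import Data.Empty using (⊥-elim)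
open import Data.Sum using (_⊎_; inj₁; inj₂)
import Data.Sum as Sum
open import Data.Product using (∃; ∃₂; _×_; _,_; proj₁; proj₂; uncurry)
open import Function using (_∘_; id; Surjective)
open import Function.Bundles using (_⇔_; mk⇔; Equivalence)
open import Relation.Nullary using (¬_; yes; no; does)
open import Relation.Nullary.Decidable using (_×-dec_; _⊎-dec_; ¬?; map′; dec-true; decidable-stable)
open import Relation.Unary using (Pred)
import Relation.Unary as U
open import Relation.Binary using (Rel; Transitive; IsDecPartialOrder)
import Relation.Binary as B
open import Relation.Binary.PropositionalEquality using (_≡_; _≢_; refl; sym; trans; cong; subst; subst₂)
open import Relation.Binary.Construct.Closure.ReflexiveTransitive using (Star; ε; _◅_; _◅◅_)
import Relation.Binary.Construct.Closure.ReflexiveTransitive as Star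
open import Relation.Binary.Construct.Closure.Transitive
  using (TransClosure; [_]; _∷_) renaming (_++_ to _⁺++_)
open import Induction.WellFounded using (Acc; acc)

private
  variable
    ℓ : Level
    n : ℕ

⟦_⟧ : {p : Pred (Fin n) ℓ} → U.Decidable p → Subset n
⟦ p? ⟧ = tabulate (does ∘ p?)

module _ {p : Pred (Fin n) ℓ} (p? : U.Decidable p) where

  ∈⟦⟧⁺ : ∀ {x} → p x → x ∈ ⟦ p? ⟧
  ∈⟦⟧⁺ {x} px = lookup⇒[]= x _ (trans (lookup∘tabulate _ x) (dec-true (p? x) px))

  ∈⟦⟧⁻ : ∀ {x} → x ∈ ⟦ p? ⟧ → p x
  ∈⟦⟧⁻ {x} x∈ with p? x | trans (sym (lookup∘tabulate (does ∘ p?) x)) ([]=⇒lookup x∈)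
  ... | yes px | _ = px

module Reachability {_⟶_ : Rel (Fin n) ℓ} (_⟶?_ : B.Decidable _⟶_) where

  ReachableFrom : Subset n → Pred (Fin n) ℓ
  ReachableFrom R z = ∃ λ y → y ∈ R × Star _⟶_ y z

  Closed : Subset n → Set ℓ
  Closed C = ∀ {y z} → y ∈ C → y ⟶ z → z ∈ C

  oneStep? : ∀ R → U.Decidable (λ z → z ∈ R ⊎ ∃ λ y → y ∈ R × y ⟶ z)
  oneStep? R z = z ∈? R ⊎-dec any? (λ y → y ∈? R ×-dec y ⟶? z)

  oneStep : Subset n → Subset n
  oneStep R = ⟦ oneStep? R ⟧

  ⊆-oneStep : ∀ {R} → R ⊆ oneStep R
  ⊆-oneStep {R} z∈R = ∈⟦⟧⁺ (oneStep? R) (inj₁ z∈R)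

  closure : ∀ R → Acc _⊃_ R → ∃ λ C → R ⊆ C × Closed C × (∀ {z} → z ∈ C → ReachableFrom R z)
  closure R (acc rs) with any? (λ z → z ∈? oneStep R ×-dec ¬? (z ∈? R))
  ... | no ∄new = R , id , closed , λ {z} z∈R → z , z∈R , ε
    where
    closed : Closed R
    closed {z = z} y∈R y⟶z =
      decidable-stable (z ∈? R) λ z∉R → ∄new (z , ∈⟦⟧⁺ (oneStep? R) (inj₂ (_ , y∈R , y⟶z)) , z∉R)
  ... | yes (z , z∈R′ , z∉R) with closure (oneStep R) (rs (⊆-oneStep , z , z∈R′ , z∉R))
  ...   | C , R′⊆C , closed , reach = C , R′⊆C ∘ ⊆-oneStep , closed , back ∘ reach
    where
    back : ∀ {w} → ReachableFrom (oneStep R) w → ReachableFrom R w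
    back (y , y∈R′ , y⇝w) with ∈⟦⟧⁻ (oneStep? R) y∈R′
    ... | inj₁ y∈R = y , y∈R , y⇝w
    ... | inj₂ (x , x∈R , x⟶y) = x , x∈R , x⟶y ◅ y⇝w

  Star? : B.Decidable (Star _⟶_)
  Star? x y with closure ⁅ x ⁆ (⊃-wellFounded _)
  ... | C , ⁅x⁆⊆C , closed , reach = map′ sound (complete (⁅x⁆⊆C (x∈⁅x⁆ x))) (y ∈? C)
    where
    sound : y ∈ C → Star _⟶_ x y
    sound y∈C with reach y∈C
    ... | w , w∈⁅x⁆ , w⇝y = subst (λ v → Star _⟶_ v y) (x∈⁅y⁆⇒x≡y x w∈⁅x⁆) w⇝y

    complete : ∀ {u v} → u ∈ C → Star _⟶_ u v → v ∈ C
    complete u∈C ε = u∈C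
    complete u∈C (u⟶w ◅ w⇝v) = complete (closed u∈C u⟶w) w⇝v

  TransClosure? : B.Decidable (TransClosure _⟶_)
  TransClosure? x y =
    map′ (λ (z , x⟶z , z⇝y) → fromStar x⟶z z⇝y) toStar (any? λ z → x ⟶? z ×-dec Star? z y)
    where
    fromStar : ∀ {x z y} → x ⟶ z → Star _⟶_ z y → TransClosure _⟶_ x y
    fromStar x⟶z ε = [ x⟶z ]
    fromStar x⟶z (z⟶w ◅ w⇝y) = x⟶z ∷ fromStar z⟶w w⇝y

    toStar : ∀ {x y} → TransClosure _⟶_ x y → ∃ λ z → x ⟶ z × Star _⟶_ z y
    toStar [ x⟶y ] = _ , x⟶y , ε
    toStar (x⟶z ∷ z⁺y) with toStar z⁺y
    ... | w , z⟶w , w⇝y = _ , x⟶z , z⟶w ◅ w⇝y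

module Covering {_<_ : Rel (Fin n) ℓ} (_<?_ : B.Decidable _<_)
                (<-trans : Transitive _<_) (<-irrefl : ∀ {x} → ¬ x < x) where

  _⋖_ : Rel (Fin n) ℓ
  x ⋖ y = x < y × (∀ z → ¬ (x < z × z < y))

  between? : ∀ x y → U.Decidable (λ z → x < z × z < y)
  between? x y z = x <? z ×-dec z <? y

  between : Fin n → Fin n → Subset n
  between x y = ⟦ between? x y ⟧

  <⇒⋖⋆ : ∀ {x y} → x < y → Star _⋖_ x y
  <⇒⋖⋆ {x} {y} = go (⊂-wellFounded (between x y))
    where
    go : ∀ {x y} → Acc _⊂_ (between x y) → x < y → Star _⋖_ x y
    go {x} {y} (acc rs) x<y with any? (between? x y)
    ... | no ∄z = (x<y , λ z x<z<y → ∄z (z , x<z<y)) ◅ ε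
    ... | yes (z , x<z , z<y) = go (rs left) x<z ◅◅ go (rs right) z<y
      where
      left : between x z ⊂ between x y
      left = (λ w∈ → let (x<w , w<z) = ∈⟦⟧⁻ (between? x z) w∈
                     in ∈⟦⟧⁺ (between? x y) (x<w , <-trans w<z z<y))
           , z , ∈⟦⟧⁺ (between? x y) (x<z , z<y) , <-irrefl ∘ proj₂ ∘ ∈⟦⟧⁻ (between? x z)
      right : between z y ⊂ between x y
      right = (λ w∈ → let (z<w , w<y) = ∈⟦⟧⁻ (between? z y) w∈
                      in ∈⟦⟧⁺ (between? x y) (<-trans x<z z<w , w<y))
            , z , ∈⟦⟧⁺ (between? x y) (x<z , z<y) , <-irrefl ∘ proj₁ ∘ ∈⟦⟧⁻ (between? z y)

module _ (P : FinPoset n) where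
  open IsDecPartialOrder (isDecPO P)
    using (isPartialOrder; _≟_; _≤?_) renaming (refl to ≤-refl; trans to ≤-trans)

  minimal-below : ∀ x → ∃ λ m → IsMin P m × _≤P_ P m x
  minimal-below x = go (po-wellFounded isPartialOrder x)
    where
    go : ∀ {x} → Acc (_<P_ P) x → ∃ λ m → IsMin P m × _≤P_ P m x
    go {x} (acc rs) with any? (λ z → z ≤? x ×-dec ¬? (z ≟ x))
    ... | yes (z , z<x) = let (m , m-min , m≤z) = go (rs z<x) in m , m-min , ≤-trans m≤z (proj₁ z<x)
    ... | no ∄z = x , (λ y y≤x → decidable-stable (y ≟ x) λ y≢x → ∄z (y , y≤x , y≢x)) , ≤-refl

Compression : ∀ {N} → (Fin n → Fin N) → Set
Compression {n} f = ∃₂ λ m (g : Fin n → Fin m) →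
  Surjective _≡_ _≡_ g
  × (∀ {x y} → f x F.≤ f y → g x F.≤ g y)
  × (∀ {x y} → g x F.≤ g y → f x F.≤ f y)

compress : ∀ {N} (f : Fin n → Fin N) → Compression f
compress {N = zero} f = _ , f , (λ ()) , id , id
compress {N = suc N} f with any? (λ v → ¬? (any? (λ x → f x F.≟ v)))
... | no ∄missed = suc N , f , hit , id , id
  where
  hit : Surjective _≡_ _≡_ f
  hit v with decidable-stable (any? (λ x → f x F.≟ v)) (λ ∄x → ∄missed (v , ∄x))
  ... | x , fx≡v = x , λ { refl → fx≡v }
... | yes (v , missed) = avoiding (λ x v≡fx → missed (x , sym v≡fx))
  where
  avoiding : (∀ x → v ≢ f x) → Compression f
  avoiding v≢f with compress (λ x → punchOut (v≢f x))
  ... | m , g , g-surj , g-mono , g-cancel =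
    m , g , g-surj , (λ {x} {y} → g-mono ∘ F.punchOut-mono-≤ (v≢f x) (v≢f y))
                   , (λ {x} {y} → F.punchOut-cancel-≤ (v≢f x) (v≢f y) ∘ g-cancel)

RankCompatible : Rel (Fin n) ℓ → SetComposition n → Set ℓ
RankCompatible _≺_ Φ = (∀ {x y} → x ≺ y → φ Φ x F.< φ Φ y)
  × (∀ {x y} → (∀ {z} → z ≺ x → z ≺ y) → (∀ {z} → z ≺ y → z ≺ x) → φ Φ x ≡ φ Φ y)

module _ {_≺_ : Rel (Fin n) ℓ} (_≺?_ : B.Decidable _≺_)
         (≺-trans : Transitive _≺_) (≺-irrefl : ∀ {x} → ¬ x ≺ x) where

  predecessors : Fin n → Subset n
  predecessors x = ⟦ (_≺? x) ⟧

  rank : Fin n → Fin (suc n)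
  rank x = fromℕ< (s≤s (∣p∣≤n (predecessors x)))

  toℕ-rank : ∀ x → F.toℕ (rank x) ≡ ∣ predecessors x ∣
  toℕ-rank x = F.toℕ-fromℕ< _

  rank-mono : ∀ {x y} → x ≺ y → rank x F.< rank y
  rank-mono {x} {y} x≺y = subst₂ ℕ._<_ (sym (toℕ-rank x)) (sym (toℕ-rank y)) (p⊂q⇒∣p∣<∣q∣ px⊂py)
    where
    px⊂py : predecessors x ⊂ predecessors y
    px⊂py = (λ z∈ → ∈⟦⟧⁺ (_≺? y) (≺-trans (∈⟦⟧⁻ (_≺? x) z∈) x≺y))
          , x , ∈⟦⟧⁺ (_≺? y) x≺y , ≺-irrefl ∘ ∈⟦⟧⁻ (_≺? x)

  rank-cong : ∀ {x y} → (∀ {z} → z ≺ x → z ≺ y) → (∀ {z} → z ≺ y → z ≺ x) → rank x ≡ rank y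
  rank-cong {x} {y} to from = F.fromℕ<-cong _ _ (cong ∣_∣ px≡py) _ _
    where
    px≡py : predecessors x ≡ predecessors y
    px≡py = ⊆-antisym (∈⟦⟧⁺ (_≺? y) ∘ to ∘ ∈⟦⟧⁻ (_≺? x)) (∈⟦⟧⁺ (_≺? x) ∘ from ∘ ∈⟦⟧⁻ (_≺? y))

  rankedComposition : ∃ (RankCompatible _≺_)
  rankedComposition with compress rank
  ... | m , g , g-surj , g-mono , g-cancel =
    record { m = m ; φ = g ; surj = g-surj } ,
    (λ x≺y → ℕ.≰⇒> (ℕ.<⇒≱ (rank-mono x≺y) ∘ g-cancel)) ,
    (λ to from → F.≤-antisym (g-mono (F.≤-reflexive (rank-cong to from)))
                             (g-mono (F.≤-reflexive (rank-cong from to))))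

module _ (Φ : SetComposition n) where

  ∈block⁺ : ∀ {x i} → φ Φ x ≡ i → x ∈ block Φ i
  ∈block⁺ {i = i} = ∈⟦⟧⁺ (λ x → φ Φ x F.≟ i)

  ∈block⁻ : ∀ {x i} → x ∈ block Φ i → φ Φ x ≡ i
  ∈block⁻ {i = i} = ∈⟦⟧⁻ (λ x → φ Φ x F.≟ i)

  ∖block? : ∀ X k → U.Decidable (λ z → z ∈ X × φ Φ z ≢ k)
  ∖block? X k z = z ∈? X ×-dec ¬? (φ Φ z F.≟ k)

  _∖block_ : Subset n → Fin (m Φ) → Subset n
  X ∖block k = ⟦ ∖block? X k ⟧

  module _ (𝓕 : Family n) where

    BlockWitness : Subset n → Fin (m Φ) → Set
    BlockWitness X i = ∃ λ A → 𝓕 A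
      × (∀ {z} → z ∈ A → i F.≤ φ Φ z)
      × (∀ {z} → φ Φ z ≡ i → z ∈ A → z ∈ X)
      × (∀ {z} → φ Φ z ≡ i → z ∈ X → z ∈ A)

    μΔ⇔blockWitnesses : ∀ X → μΔ Φ 𝓕 X ⇔ (∀ i → BlockWitness X i)
    μΔ⇔blockWitnesses X = mk⇔ witnesses fromWitnesses
      where
      witnesses : μΔ Φ 𝓕 X → ∀ i → BlockWitness X i
      witnesses (Xs , rf , mem) i = A i , proj₁ (proj₂ (rf i)) , misses , agree⇒ , agree⇐
        where
        A : Fin (m Φ) → Subset n
        A j = proj₁ (rf j)

        A-missesEarlier : ∀ j k → k F.< j → A j ∩ block Φ k ≡ ⊥
        A-missesEarlier j = proj₁ (proj₂ (proj₂ (rf j)))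

        Xs≡A∩block : ∀ j → Xs j ≡ A j ∩ block Φ j
        Xs≡A∩block j = proj₂ (proj₂ (proj₂ (rf j)))

        ∈Xs⁻ : ∀ {z j} → z ∈ Xs j → z ∈ A j × φ Φ z ≡ j
        ∈Xs⁻ {z} {j} z∈ with x∈p∩q⁻ (A j) (block Φ j) (subst (z ∈_) (Xs≡A∩block j) z∈)
        ... | z∈A , z∈B = z∈A , ∈block⁻ z∈B

        misses : ∀ {z} → z ∈ A i → i F.≤ φ Φ z
        misses {z} z∈A = ℕ.≮⇒≥ λ φz<i →
          ∉⊥ (subst (z ∈_) (A-missesEarlier i (φ Φ z) φz<i) (x∈p∩q⁺ (z∈A , ∈block⁺ refl)))

        agree⇒ : ∀ {z} → φ Φ z ≡ i → z ∈ A i → z ∈ X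
        agree⇒ {z} φz≡i z∈A = Equivalence.from (mem z)
          (i , subst (z ∈_) (sym (Xs≡A∩block i)) (x∈p∩q⁺ (z∈A , ∈block⁺ φz≡i)))

        agree⇐ : ∀ {z} → φ Φ z ≡ i → z ∈ X → z ∈ A i
        agree⇐ {z} φz≡i z∈X with Equivalence.to (mem z) z∈X
        ... | j , z∈Xsj =
          proj₁ (∈Xs⁻ (subst (λ k → z ∈ Xs k) (trans (sym (proj₂ (∈Xs⁻ z∈Xsj))) φz≡i) z∈Xsj))

      fromWitnesses : (∀ i → BlockWitness X i) → μΔ Φ 𝓕 X
      fromWitnesses ws = (λ i → X ∩ block Φ i) , restricted , λ z → mk⇔
          (λ z∈X → φ Φ z , x∈p∩q⁺ (z∈X , ∈block⁺ refl))
          (λ (_ , z∈) → proj₁ (x∈p∩q⁻ X _ z∈))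
        where
        restricted : ∀ i → restrictFam Φ 𝓕 i (X ∩ block Φ i)
        restricted i with ws i
        ... | A , A∈𝓕 , misses , agree⇒ , agree⇐ = A , A∈𝓕 , missesEarlier , sameTrace
          where
          missesEarlier : ∀ j → j F.< i → A ∩ block Φ j ≡ ⊥
          missesEarlier j j<i = Empty-unique λ (z , z∈) →
            let (z∈A , z∈Bj) = x∈p∩q⁻ A (block Φ j) z∈
            in ℕ.<⇒≱ (subst (F._< i) (sym (∈block⁻ z∈Bj)) j<i) (misses z∈A)

          sameTrace : X ∩ block Φ i ≡ A ∩ block Φ i
          sameTrace = ⊆-antisym
            (λ z∈ → let (z∈X , z∈B) = x∈p∩q⁻ X _ z∈ in x∈p∩q⁺ (agree⇐ (∈block⁻ z∈B) z∈X , z∈B))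
            (λ z∈ → let (z∈A , z∈B) = x∈p∩q⁻ A _ z∈ in x∈p∩q⁺ (agree⇒ (∈block⁻ z∈B) z∈A , z∈B))

    module _ (𝓕-grounded : 𝓕 ⊥) where

      ⊥-blockWitness : ∀ {X i} → (∀ {z} → φ Φ z ≡ i → z ∉ X) → BlockWitness X i
      ⊥-blockWitness z∉X =
        ⊥ , 𝓕-grounded , (⊥-elim ∘ ∉⊥) , (λ _ → ⊥-elim ∘ ∉⊥) , λ φz≡i z∈X → ⊥-elim (z∉X φz≡i z∈X)

      μΔ-deleteBlock : ∀ {X} k → μΔ Φ 𝓕 X → μΔ Φ 𝓕 (X ∖block k)
      μΔ-deleteBlock {X} k μX = Equivalence.from (μΔ⇔blockWitnesses _) witness
        where
        witness : ∀ i → BlockWitness (X ∖block k) i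
        witness i with i F.≟ k | Equivalence.to (μΔ⇔blockWitnesses X) μX i
        ... | yes refl | _ = ⊥-blockWitness λ φz≡k z∈ → proj₂ (∈⟦⟧⁻ (∖block? X k) z∈) φz≡k
        ... | no i≢k | A , A∈𝓕 , misses , agree⇒ , agree⇐ =
          A , A∈𝓕 , misses ,
          (λ φz≡i z∈A → ∈⟦⟧⁺ (∖block? X k) (agree⇒ φz≡i z∈A , λ φz≡k → i≢k (trans (sym φz≡i) φz≡k))) ,
          (λ φz≡i z∈ → agree⇐ φz≡i (proj₁ (∈⟦⟧⁻ (∖block? X k) z∈)))

      μΔ-singleBlock : ∀ {A k} → 𝓕 A → (∀ {z} → z ∈ A → φ Φ z ≡ k) → μΔ Φ 𝓕 A
      μΔ-singleBlock {A} {k} A∈𝓕 A⊆block = Equivalence.from (μΔ⇔blockWitnesses A) witness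
        where
        witness : ∀ i → BlockWitness A i
        witness i with i F.≤? k
        ... | yes i≤k =
          A , A∈𝓕 , (λ z∈A → subst (i F.≤_) (sym (A⊆block z∈A)) i≤k) , (λ _ → id) , (λ _ → id)
        ... | no i≰k = ⊥-blockWitness λ φz≡i z∈A → i≰k (F.≤-reflexive (trans (sym φz≡i) (A⊆block z∈A)))

module _ {P : FinPoset n} where
  open IsDecPartialOrder (isDecPO P) using ()
    renaming (_≤?_ to _≤P?_; refl to ≤P-refl; trans to ≤P-trans; antisym to ≤P-antisym)

  J-grounded : J P ⊥
  J-grounded _ _ y∈⊥ _ = ⊥-elim (∉⊥ y∈⊥)

  minimal⇒singleton∈J : ∀ {x} → IsMin P x → J P ⁅ x ⁆
  minimal⇒singleton∈J {x} x-min z y y∈⁅x⁆ z≤y =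
    subst (_∈ ⁅ x ⁆) (sym (x-min z (subst (_≤P_ P z) (x∈⁅y⁆⇒x≡y x y∈⁅x⁆) z≤y))) (x∈⁅x⁆ x)

  module _ (Q : Fracturing P) where

    _≤Q?_ : B.Decidable (_≤Q_ Q)
    x ≤Q? y = x ∈? S Q ×-dec (y ∈? S Q ×-dec (summand Q x ℕ.≟ summand Q y ×-dec x ≤P? y))

    _<Q?_ : B.Decidable (_<Q_ Q)
    x <Q? y = x ≤Q? y ×-dec ¬? (x F.≟ y)

    ≤Q-refl : ∀ {x} → x ∈ S Q → _≤Q_ Q x x
    ≤Q-refl x∈S = x∈S , x∈S , refl , ≤P-refl

    ≤Q-trans : Transitive (_≤Q_ Q)
    ≤Q-trans (x∈S , _ , x~y , x≤y) (_ , z∈S , y~z , y≤z) =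
      x∈S , z∈S , trans x~y y~z , ≤P-trans x≤y y≤z

    <Q-trans : Transitive (_<Q_ Q)
    <Q-trans (x≤y@(_ , _ , _ , x≤Py) , x≢y) (y≤z@(_ , _ , _ , y≤Pz) , _) =
      ≤Q-trans x≤y y≤z , λ { refl → x≢y (≤P-antisym x≤Py y≤Pz) }

    ↓Q : Fin n → Subset n
    ↓Q b = ⟦ (_≤Q? b) ⟧

    ↓Q∈JQ : ∀ b → JQ Q (↓Q b)
    ↓Q∈JQ b = (λ z∈ → proj₁ (∈⟦⟧⁻ (_≤Q? b) z∈))
            , λ x y y∈ x≤y → ∈⟦⟧⁺ (_≤Q? b) (≤Q-trans x≤y (∈⟦⟧⁻ (_≤Q? b) y∈))

    open Covering _<Q?_ <Q-trans (λ x<x → proj₂ x<x refl) using (<⇒⋖⋆)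

    ≤Q⇒SameComp : ∀ {x y} → _≤Q_ Q x y → SameComp Q x y
    ≤Q⇒SameComp {x} {y} x≤y with x F.≟ y
    ... | yes refl = ε
    ... | no x≢y = Star.map inj₁ (<⇒⋖⋆ (x≤y , x≢y))

    SameComp-sym : ∀ {x y} → SameComp Q x y → SameComp Q y x
    SameComp-sym = Star.reverse Sum.swap

    SameComp-invariant : ∀ {a} {A : Set a} (f : Fin n → A) →
      (∀ {x y} → _≤Q_ Q x y → f x ≡ f y) → ∀ {x y} → SameComp Q x y → f x ≡ f y
    SameComp-invariant f f-inv = Star.fold (λ x y → f x ≡ f y) step refl
      where
      step : ∀ {x y z} → HasseEdge Q x y → f y ≡ f z → f x ≡ f z
      step (inj₁ ((x≤y , _) , _)) = trans (f-inv x≤y)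
      step (inj₂ ((y≤x , _) , _)) = trans (sym (f-inv y≤x))

    SameComp-∈S : ∀ {x y} → SameComp Q x y → x ∈ S Q → y ∈ S Q
    SameComp-∈S = Star.fold (λ x y → x ∈ S Q → y ∈ S Q) step id
      where
      step : ∀ {x y z} → HasseEdge Q x y → (y ∈ S Q → z ∈ S Q) → x ∈ S Q → z ∈ S Q
      step (inj₁ ((x≤y , _) , _)) y⇒z _ = y⇒z (proj₁ (proj₂ x≤y))
      step (inj₂ ((y≤x , _) , _)) y⇒z _ = y⇒z (proj₁ y≤x)

    ConEdge-respʳ : ∀ {a b c} → ConEdge Q a b → SameComp Q b c → ConEdge Q a c
    ConEdge-respʳ (a∈S , b∈S , a≁b , x , y , a~x , b~y , y<x) b~c =
      a∈S , SameComp-∈S b~c b∈S , (λ a~c → a≁b (a~c ◅◅ SameComp-sym b~c))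
      , x , y , a~x , SameComp-sym b~c ◅◅ b~y , y<x

    ConPath-respʳ : ∀ {a b c} →
      TransClosure (ConEdge Q) a b → SameComp Q b c → TransClosure (ConEdge Q) a c
    ConPath-respʳ [ a→b ] b~c = [ ConEdge-respʳ a→b b~c ]
    ConPath-respʳ (a→x ∷ x⇝b) b~c = a→x ∷ ConPath-respʳ x⇝b b~c

    ConPath-source∈S : ∀ {a b} → TransClosure (ConEdge Q) a b → a ∈ S Q
    ConPath-source∈S [ a→b ] = proj₁ a→b
    ConPath-source∈S (a→x ∷ _) = proj₁ a→x

    HasseEdge? : B.Decidable (HasseEdge Q)
    HasseEdge? x y = ⋖? x y ⊎-dec ⋖? y x
      where
      ⋖? : B.Decidable (_⋖Q_ Q)
      ⋖? x y = x <Q? y ×-dec all? (λ z → ¬? (x <Q? z ×-dec z <Q? y))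

    open Reachability HasseEdge? using () renaming (Star? to SameComp?)

    ConEdge? : B.Decidable (ConEdge Q)
    ConEdge? a b = a ∈? S Q ×-dec (b ∈? S Q ×-dec (¬? (SameComp? a b) ×-dec any? λ x → any? λ y →
      SameComp? a x ×-dec (SameComp? b y ×-dec (y ≤P? x ×-dec ¬? (y F.≟ x)))))

    open Reachability ConEdge? using () renaming (TransClosure? to ConPath?)

    module _ (Φ : SetComposition n) (Φ-good : ∀ X → μΔ Φ (J P) X ⇔ JQ Q X) where

      ↓Q∈μΔ : ∀ b → μΔ Φ (J P) (↓Q b)
      ↓Q∈μΔ b = Equivalence.from (Φ-good (↓Q b)) (↓Q∈JQ b)

      ≤Q⇒sameBlock : ∀ {a b} → _≤Q_ Q a b → φ Φ a ≡ φ Φ b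
      -- Otherwise ↓b with the block of a deleted is a Q-ideal containing b, hence a.
      ≤Q⇒sameBlock {a} {b} a≤b = decidable-stable (φ Φ a F.≟ φ Φ b) λ φa≢φb →
        let k = φ Φ a
            X = _∖block_ Φ (↓Q b) k
            X∈JQ = Equivalence.to (Φ-good X) (μΔ-deleteBlock Φ (J P) J-grounded k (↓Q∈μΔ b))
            b∈↓b = ∈⟦⟧⁺ (_≤Q? b) (≤Q-refl (proj₁ (proj₂ a≤b)))
            b∈X = ∈⟦⟧⁺ (∖block? Φ (↓Q b) k) (b∈↓b , φa≢φb ∘ sym)
            a∈X = proj₂ X∈JQ a b b∈X a≤b
        in proj₂ (∈⟦⟧⁻ (∖block? Φ (↓Q b) k) a∈X) refl

      ConEdge⇒earlierBlock : ∀ {a b} → ConEdge Q a b → φ Φ a F.< φ Φ b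
      ConEdge⇒earlierBlock (a∈S , _ , a≁b , x , y , a~x , b~y , y≤x , _) =
        subst₂ F._<_ (sym (φ-sameComp a~x)) (sym (φ-sameComp b~y)) φx<φy
        where
        φ-sameComp : ∀ {x y} → SameComp Q x y → φ Φ x ≡ φ Φ y
        φ-sameComp = SameComp-invariant (φ Φ) ≤Q⇒sameBlock

        x∈↓x : x ∈ ↓Q x
        x∈↓x = ∈⟦⟧⁺ (_≤Q? x) (≤Q-refl (SameComp-∈S a~x a∈S))

        φx<φy : φ Φ x F.< φ Φ y
        φx<φy with Equivalence.to (μΔ⇔blockWitnesses Φ (J P) (↓Q x)) (↓Q∈μΔ x) (φ Φ x)
        ... | A , A∈J , misses , agree⇒ , agree⇐ = F.≤∧≢⇒< (misses y∈A) λ φx≡φy →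
          let y≤Qx = ∈⟦⟧⁻ (_≤Q? x) (agree⇒ (sym φx≡φy) y∈A)
          in a≁b (a~x ◅◅ SameComp-sym (≤Q⇒SameComp y≤Qx) ◅◅ SameComp-sym b~y)
          where
          y∈A : y ∈ A
          y∈A = A∈J y x (agree⇐ refl x∈↓x) y≤x

      ConPath⇒earlierBlock : ∀ {a b} → TransClosure (ConEdge Q) a b → φ Φ a F.< φ Φ b
      ConPath⇒earlierBlock [ a→b ] = ConEdge⇒earlierBlock a→b
      ConPath⇒earlierBlock (a→x ∷ x⇝b) =
        ℕ.<-trans (ConEdge⇒earlierBlock a→x) (ConPath⇒earlierBlock x⇝b)

      good⇒acyclic : ConAcyclic Q
      good⇒acyclic _ _ a⇝a = F.<-irrefl refl (ConPath⇒earlierBlock a⇝a)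

      good⇒containsMin : ContainsMin Q
      good⇒containsMin x x-min = proj₁ (Equivalence.to (Φ-good ⁅ x ⁆) ⁅x⁆∈μΔ) (x∈⁅x⁆ x)
        where
        ⁅x⁆∈μΔ : μΔ Φ (J P) ⁅ x ⁆
        ⁅x⁆∈μΔ =
          μΔ-singleBlock Φ (J P) J-grounded (minimal⇒singleton∈J x-min) (cong (φ Φ) ∘ x∈⁅y⁆⇒x≡y x)

    -- Putting all of Q before the elements outside Q is what keeps the members of
    -- μ_ΦΔ_Φ(J(P)) inside Q, as they contain minimal elements below their elements.
    Before : Rel (Fin n) 0ℓ
    Before z x = TransClosure (ConEdge Q) z x ⊎ (z ∈ S Q × x ∉ S Q)

    Before? : B.Decidable Before
    Before? z x = ConPath? z x ⊎-dec (z ∈? S Q ×-dec ¬? (x ∈? S Q))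

    Before-trans : Transitive Before
    Before-trans (inj₁ x⇝y) (inj₁ y⇝z) = inj₁ (x⇝y ⁺++ y⇝z)
    Before-trans (inj₁ x⇝y) (inj₂ (_ , z∉S)) = inj₂ (ConPath-source∈S x⇝y , z∉S)
    Before-trans (inj₂ (_ , y∉S)) (inj₁ y⇝z) = ⊥-elim (y∉S (ConPath-source∈S y⇝z))
    Before-trans (inj₂ (_ , y∉S)) (inj₂ (y∈S , _)) = ⊥-elim (y∉S y∈S)

    acyclic⇒Before-irrefl : ConAcyclic Q → ∀ {x} → ¬ Before x x
    acyclic⇒Before-irrefl acyclic (inj₁ x⇝x) = acyclic _ (ConPath-source∈S x⇝x) x⇝x
    acyclic⇒Before-irrefl _ (inj₂ (x∈S , x∉S)) = x∉S x∈S

    Before-respʳ : ∀ {x y z} → x ∈ S Q → SameComp Q x y → Before z x → Before z y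
    Before-respʳ _ x~y (inj₁ z⇝x) = inj₁ (ConPath-respʳ z⇝x x~y)
    Before-respʳ x∈S _ (inj₂ (_ , x∉S)) = ⊥-elim (x∉S x∈S)

    module _ (containsMin : ContainsMin Q)
             (Φ : SetComposition n) (compatible : RankCompatible Before Φ) where

      Before⇒earlierBlock : ∀ {x y} → Before x y → φ Φ x F.< φ Φ y
      Before⇒earlierBlock = proj₁ compatible

      SameComp⇒sameBlock : ∀ {x y} → x ∈ S Q → SameComp Q x y → φ Φ x ≡ φ Φ y
      SameComp⇒sameBlock x∈S x~y =
        proj₂ compatible (Before-respʳ x∈S x~y) (Before-respʳ (SameComp-∈S x~y x∈S) (SameComp-sym x~y))

      ≤P⇒≤Q⊎laterBlock : ∀ {x y} → x ∈ S Q → _≤P_ P y x → _≤Q_ Q y x ⊎ φ Φ x F.< φ Φ y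
      ≤P⇒≤Q⊎laterBlock {x} {y} x∈S y≤x with y ∈? S Q | summand Q y ℕ.≟ summand Q x
      ... | no y∉S | _ = inj₂ (Before⇒earlierBlock (inj₂ (x∈S , y∉S)))
      ... | yes y∈S | yes y~x = inj₁ (y∈S , x∈S , y~x , y≤x)
      ... | yes y∈S | no y≁x = inj₂ (Before⇒earlierBlock (inj₁ [ x→y ]))
        where
        x→y : ConEdge Q x y
        x→y = x∈S , y∈S , (y≁x ∘ sym ∘ SameComp-invariant (summand Q) (proj₁ ∘ proj₂ ∘ proj₂))
            , x , y , ε , ε , y≤x , y≁x ∘ cong (summand Q)

      φ-antitone : ∀ {x y} → x ∈ S Q → _≤P_ P y x → φ Φ x F.≤ φ Φ y
      φ-antitone x∈S y≤x with ≤P⇒≤Q⊎laterBlock x∈S y≤x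
      ... | inj₁ y≤Qx = F.≤-reflexive (sym (SameComp⇒sameBlock (proj₁ y≤Qx) (≤Q⇒SameComp y≤Qx)))
      ... | inj₂ φx<φy = ℕ.<⇒≤ φx<φy

      μΔ⇒JQ : ∀ X → μΔ Φ (J P) X → JQ Q X
      μΔ⇒JQ X X∈μΔ = X⊆S , X-ideal
        where
        witness : ∀ i → BlockWitness Φ (J P) X i
        witness = Equivalence.to (μΔ⇔blockWitnesses Φ (J P) X) X∈μΔ

        X⊆S : X ⊆ S Q
        X⊆S {x} x∈X with witness (φ Φ x)
        ... | A , A∈J , misses , _ , agree⇐ = decidable-stable (x ∈? S Q) λ x∉S →
          let (m , m-min , m≤x) = minimal-below P x
          in ℕ.<⇒≱ (Before⇒earlierBlock (inj₂ (containsMin m m-min , x∉S))) (misses (A∈J m x (agree⇐ refl x∈X) m≤x))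

        X-ideal : ∀ y x → x ∈ X → _≤Q_ Q y x → y ∈ X
        X-ideal y x x∈X y≤x with witness (φ Φ x)
        ... | A , A∈J , _ , agree⇒ , agree⇐ =
          agree⇒ (SameComp⇒sameBlock (proj₁ y≤x) (≤Q⇒SameComp y≤x))
                 (A∈J y x (agree⇐ refl x∈X) (proj₂ (proj₂ (proj₂ y≤x))))

      JQ⇒μΔ : ∀ X → JQ Q X → μΔ Φ (J P) X
      JQ⇒μΔ X (X⊆S , X-ideal) = Equivalence.from (μΔ⇔blockWitnesses Φ (J P) X) witness
        where
        below? : ∀ i → U.Decidable (λ y → ∃ λ x → x ∈ X × φ Φ x ≡ i × _≤P_ P y x)
        below? i y = any? (λ x → x ∈? X ×-dec (φ Φ x F.≟ i ×-dec y ≤P? x))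

        witness : ∀ i → BlockWitness Φ (J P) X i
        witness i = ⟦ below? i ⟧ , A∈J , misses , agree⇒ , agree⇐
          where
          A∈J : J P ⟦ below? i ⟧
          A∈J z y y∈A z≤y with ∈⟦⟧⁻ (below? i) y∈A
          ... | x , x∈X , φx≡i , y≤x = ∈⟦⟧⁺ (below? i) (x , x∈X , φx≡i , ≤P-trans z≤y y≤x)

          misses : ∀ {z} → z ∈ ⟦ below? i ⟧ → i F.≤ φ Φ z
          misses z∈A with ∈⟦⟧⁻ (below? i) z∈A
          ... | x , x∈X , refl , z≤x = φ-antitone (X⊆S x∈X) z≤x

          agree⇒ : ∀ {z} → φ Φ z ≡ i → z ∈ ⟦ below? i ⟧ → z ∈ X
          agree⇒ φz≡i z∈A with ∈⟦⟧⁻ (below? i) z∈A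
          ... | x , x∈X , φx≡i , z≤x with ≤P⇒≤Q⊎laterBlock (X⊆S x∈X) z≤x
          ...   | inj₁ z≤Qx = X-ideal _ x x∈X z≤Qx
          ...   | inj₂ φx<φz = ⊥-elim (F.<-irrefl (trans φx≡i (sym φz≡i)) φx<φz)

          agree⇐ : ∀ {z} → φ Φ z ≡ i → z ∈ X → z ∈ ⟦ below? i ⟧
          agree⇐ φz≡i z∈X = ∈⟦⟧⁺ (below? i) (_ , z∈X , φz≡i , ≤P-refl)

      compatible⇒good : Good Q
      compatible⇒good = Φ , λ X → mk⇔ (μΔ⇒JQ X) (JQ⇒μΔ X)

    containsMin×acyclic⇒good : ContainsMin Q → ConAcyclic Q → Good Q
    containsMin×acyclic⇒good containsMin acyclic =
      uncurry (compatible⇒good containsMin)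
              (rankedComposition Before? Before-trans (acyclic⇒Before-irrefl acyclic))

proposition4p12 : (n : ℕ) (P : FinPoset n) (Q : Fracturing P) → Good Q ⇔ (ContainsMin Q × ConAcyclic Q)
proposition4p12 n P Q = mk⇔
  (λ (Φ , Φ-good) → good⇒containsMin Q Φ Φ-good , good⇒acyclic Q Φ Φ-good)
  (λ (containsMin , acyclic) → containsMin×acyclic⇒good Q containsMin acyclic)
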